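{- For any enriched formal $\mathbf{A}$-context $\mathbb{F} = (\mathbb{P}, R_{\Box}, R_{\Diamond})$, the algebra $\mathbb{F}^+ = (\mathbb{P}^+, [R_{\Box}], \langle R_{\Diamond}\rangle)$ is a complete normal lattice expansion such that $[R_\Box]$ is completely meet-preserving and $\langle R_\Diamond\rangle$ is completely join-preserving.
   Context: $\mathbf{A}$ is a complete Heyting algebra of truth values. For an $\mathbf{A}$-valued relation $R: U\times W\to\mathbf{A}$, $R^{(1)}[f](x)=\bigwedge_{a\in U}(f(a)\to R(a,x))$ for $f\in\mathbf{A}^U$ and $R^{(0)}[u](a)=\bigwedge_{x\in W}(u(x)\to R(a,x))$ for $u\in\mathbf{A}^W$. A formal $\mathbf{A}$-context is $\mathbb{P}=(A,X,I)$ with $I:A\times X\to\mathbf{A}$; $(\cdot)^\uparrow=I^{(1)}[\cdot]$, $(\cdot)^\downarrow=I^{(0)}[\cdot]$; formal $\mathbf{A}$-concepts are pairs $(f,u)$ with $f^\uparrow=u$, $u^\downarrow=f$, ordered by $f\subseteq g$ pointwise, forming the complete lattice $\mathbb{P}^+$. An enriched formal $\mathbf{A}$-context is $(\mathbb{P},R_\Box,R_\Diamond)$ with $R_\Box:A\times X\to\mathbf{A}$, $R_\Diamond:X\times A\to\mathbf{A}$ $I$-compatible, i.e.\ $R_{\Box}^{(0)}[\{\alpha / x\}]$, $R_{\Box}^{(1)}[\{\alpha / a\}]$, $R_{\Diamond}^{(0)}[\{\alpha / a\}]$, $R_{\Diamond}^{(1)}[\{\alpha / x\}]$ are Galois-stable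 for all $\alpha$, $a$, $x$ (where $\{\alpha/w\}$ maps $w$ to $\alpha$ and all else to $\bot$). For $c=([\![c]\!],(\![c]\!))\in\mathbb{P}^+$ (extension and intension), $[R_{\Box}]c = (R_{\Box}^{(0)}[(\![c]\!)], (R_{\Box}^{(0)}[(\![c]\!)])^{\uparrow})$ and $\langle R_{\Diamond} \rangle c = ((R_{\Diamond}^{(0)}[[\![c]\!]])^{\downarrow}, R_{\Diamond}^{(0)}[[\![c]\!]])$. -}

module Defs where

open import Level using (Level; _⊔_) renaming (suc to lsuc)
open import Relation.Binary.PropositionalEquality using (_≡_)
open import Relation.Binary.Lattice.Bundles using (HeytingAlgebra)
open import Data.Product using (_×_; Σ; _,_)

record CompleteHeytingAlgebra (c ℓ₁ ℓ₂ ι : Level) : Set (lsuc (c ⊔ ℓ₁ ⊔ ℓ₂ ⊔ ι)) where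
  field
    heytingAlgebra : HeytingAlgebra c ℓ₁ ℓ₂
  open HeytingAlgebra heytingAlgebra public
  field
    ⋀ : {J : Set ι} → (J → Carrier) → Carrier
    ⋁ : {J : Set ι} → (J → Carrier) → Carrier
    ⋀-lower    : {J : Set ι} (h : J → Carrier) (j : J) → ⋀ h ≤ h j
    ⋀-greatest : {J : Set ι} (h : J → Carrier) (z : Carrier) → (∀ j → z ≤ h j) → z ≤ ⋀ h
    ⋁-upper    : {J : Set ι} (h : J → Carrier) (j : J) → h j ≤ ⋁ h
    ⋁-least    : {J : Set ι} (h : J → Carrier) (z : Carrier) → (∀ j → h j ≤ z) → ⋁ h ≤ z

module Contexts {c ℓ₁ ℓ₂ ι : Level} (𝐀 : CompleteHeytingAlgebra c ℓ₁ ℓ₂ ι) where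
  open CompleteHeytingAlgebra 𝐀

  _⁽¹⁾[_] : {U W : Set ι} → (U → W → Carrier) → (U → Carrier) → (W → Carrier)
  (R ⁽¹⁾[ f ]) x = ⋀ (λ a → f a ⇨ R a x)

  _⁽⁰⁾[_] : {U W : Set ι} → (U → W → Carrier) → (W → Carrier) → (U → Carrier)
  (R ⁽⁰⁾[ u ]) a = ⋀ (λ x → u x ⇨ R a x)

  -- {α / w}: maps w to α and everything else to ⊥.
  -- Rendered constructively as v ↦ ⋁_{p : w ≡ v} α (classically identical).
  ⟦_/_⟧ : {W : Set ι} → Carrier → W → (W → Carrier)
  ⟦ α / w ⟧ v = ⋁ {J = w ≡ v} (λ _ → α)

  _⊆_ : {U : Set ι} → (U → Carrier) → (U → Carrier) → Set (ι ⊔ ℓ₂)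
  f ⊆ g = ∀ a → f a ≤ g a

  _≐_ : {U : Set ι} → (U → Carrier) → (U → Carrier) → Set (ι ⊔ ℓ₁)
  f ≐ g = ∀ a → f a ≈ g a

  record FormalContext : Set (lsuc ι ⊔ c) where
    field
      Obj : Set ι
      Feat : Set ι
      I : Obj → Feat → Carrier

  module _ (P : FormalContext) where
    open FormalContext P

    _↑ : (Obj → Carrier) → (Feat → Carrier)
    f ↑ = I ⁽¹⁾[ f ]

    _↓ : (Feat → Carrier) → (Obj → Carrier)
    u ↓ = I ⁽⁰⁾[ u ]

    StableObj : (Obj → Carrier) → Set (ι ⊔ ℓ₁)
    StableObj f = ((f ↑) ↓) ≐ f

    StableFeat : (Feat → Carrier) → Set (ι ⊔ ℓ₁)
    StableFeat u = ((u ↓) ↑) ≐ u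

    Pair : Set (ι ⊔ c)
    Pair = (Obj → Carrier) × (Feat → Carrier)

    IsConcept : Pair → Set (ι ⊔ ℓ₁)
    IsConcept (f , u) = ((f ↑) ≐ u) × ((u ↓) ≐ f)

    Concept : Set (ι ⊔ c ⊔ ℓ₁)
    Concept = Σ Pair IsConcept

    ext : Concept → (Obj → Carrier)
    ext ((f , _) , _) = f

    int : Concept → (Feat → Carrier)
    int ((_ , u) , _) = u

    _⊑_ : Concept → Concept → Set (ι ⊔ ℓ₂)
    c₁ ⊑ c₂ = ext c₁ ⊆ ext c₂

    IsMeet : {J : Set ι} → (J → Concept) → Concept → Set (ι ⊔ c ⊔ ℓ₁ ⊔ ℓ₂)
    IsMeet cs m = (∀ j → m ⊑ cs j) × (∀ z → (∀ j → z ⊑ cs j) → z ⊑ m)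

    IsJoin : {J : Set ι} → (J → Concept) → Concept → Set (ι ⊔ c ⊔ ℓ₁ ⊔ ℓ₂)
    IsJoin cs m = (∀ j → cs j ⊑ m) × (∀ z → (∀ j → cs j ⊑ z) → m ⊑ z)

  record EnrichedContext : Set (lsuc ι ⊔ c ⊔ ℓ₁) where
    field
      ℙ : FormalContext
    open FormalContext ℙ public
    field
      R□ : Obj → Feat → Carrier
      R◇ : Feat → Obj → Carrier
      compat-□⁰ : ∀ α x → StableObj ℙ (R□ ⁽⁰⁾[ ⟦ α / x ⟧ ])
      compat-□¹ : ∀ α a → StableFeat ℙ (R□ ⁽¹⁾[ ⟦ α / a ⟧ ])
      compat-◇⁰ : ∀ α a → StableFeat ℙ (R◇ ⁽⁰⁾[ ⟦ α / a ⟧ ])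
      compat-◇¹ : ∀ α x → StableObj ℙ (R◇ ⁽¹⁾[ ⟦ α / x ⟧ ])

  module _ (F : EnrichedContext) where
    open EnrichedContext F

    [R□]-pair : Concept ℙ → Pair ℙ
    [R□]-pair c = (R□ ⁽⁰⁾[ int ℙ c ]) , _↑ ℙ (R□ ⁽⁰⁾[ int ℙ c ])

    ⟨R◇⟩-pair : Concept ℙ → Pair ℙ
    ⟨R◇⟩-pair c = _↓ ℙ (R◇ ⁽⁰⁾[ ext ℙ c ]) , (R◇ ⁽⁰⁾[ ext ℙ c ])

    record IsCompleteNormalLE : Set (lsuc ι ⊔ c ⊔ ℓ₁ ⊔ ℓ₂) where
      field
        meets : {J : Set ι} (cs : J → Concept ℙ) → Σ (Concept ℙ) (IsMeet ℙ cs)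
        joins : {J : Set ι} (cs : J → Concept ℙ) → Σ (Concept ℙ) (IsJoin ℙ cs)
        [R□]-concept : (c : Concept ℙ) → IsConcept ℙ ([R□]-pair c)
        ⟨R◇⟩-concept : (c : Concept ℙ) → IsConcept ℙ (⟨R◇⟩-pair c)

      [R□] : Concept ℙ → Concept ℙ
      [R□] c = [R□]-pair c , [R□]-concept c

      ⟨R◇⟩ : Concept ℙ → Concept ℙ
      ⟨R◇⟩ c = ⟨R◇⟩-pair c , ⟨R◇⟩-concept c

      field
        -- [R□] preserves arbitrary meets (in particular it is normal: ⊤ and binary meets)
        [R□]-meet : {J : Set ι} (cs : J → Concept ℙ) (m : Concept ℙ) →
                    IsMeet ℙ cs m → IsMeet ℙ (λ j → [R□] (cs j)) ([R□] m)
        -- ⟨R◇⟩ preserves arbitrary joins (in particular it is normal: ⊥ and binary joins)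
        ⟨R◇⟩-join : {J : Set ι} (cs : J → Concept ℙ) (m : Concept ℙ) →
                    IsJoin ℙ cs m → IsJoin ℙ (λ j → ⟨R◇⟩ (cs j)) (⟨R◇⟩ m)

{-# OPTIONS --safe #-}
module Submission where

open import Defs
open import Level using (Level)
open import Function using (flip)
open import Data.Product using (Σ; _,_; proj₂)
open import Relation.Binary.PropositionalEquality using () renaming (refl to ≡-refl)
import Relation.Binary.Lattice.Properties.HeytingAlgebra as HeytingAlgebraProperties

-- Concepts correspond to Galois-closed 𝐀-sets, which are closed under arbitrary meets.
-- Since R⁽⁰⁾[u] is the meet of the R⁽⁰⁾[{u x / x}], I-compatibility (stated for
-- singletons only) makes every R□⁽⁰⁾[u], R□⁽¹⁾[f], R◇⁽⁰⁾[f], R◇⁽¹⁾[u] closed, so [R□]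
-- and ⟨R◇⟩ are well defined. For a lower bound z of the [R□] cs j, the closed intent
-- R□⁽¹⁾[ext z] lies above every intent of cs j, hence above the intent of their meet,
-- and the Galois connection of R□ transports this back to z ⊑ [R□] m; ⟨R◇⟩ is dual.

module Polarity {c ℓ₁ ℓ₂ ι : Level} (𝐀 : CompleteHeytingAlgebra c ℓ₁ ℓ₂ ι) where
  open CompleteHeytingAlgebra 𝐀
  open HeytingAlgebraProperties heytingAlgebra using (⇨ˡ-contravariant; swap-transpose-⇨)
  open Contexts 𝐀

  private variable
    U V W : Set ι

  ⊆-refl : {f : U → Carrier} → f ⊆ f
  ⊆-refl a = refl

  ⊆-trans : {f g h : U → Carrier} → f ⊆ g → g ⊆ h → f ⊆ h
  ⊆-trans p q a = trans (p a) (q a)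

  ⊆-antisym : {f g : U → Carrier} → f ⊆ g → g ⊆ f → f ≐ g
  ⊆-antisym p q a = antisym (p a) (q a)

  ≐⇒⊆ : {f g : U → Carrier} → f ≐ g → f ⊆ g
  ≐⇒⊆ p a = reflexive (p a)

  ≐⇒⊇ : {f g : U → Carrier} → f ≐ g → g ⊆ f
  ≐⇒⊇ p a = reflexive (Eq.sym (p a))

  ⁽⁰⁾-galois : (R : U → W → Carrier) {f : U → Carrier} {u : W → Carrier} →
               f ⊆ (R ⁽⁰⁾[ u ]) → u ⊆ (R ⁽¹⁾[ f ])
  ⁽⁰⁾-galois R p x = ⋀-greatest _ _ λ a →
    swap-transpose-⇨ (transpose-∧ (trans (p a) (⋀-lower _ x)))

  ⁽¹⁾-galois : (R : U → W → Carrier) {f : U → Carrier} {u : W → Carrier} →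
               u ⊆ (R ⁽¹⁾[ f ]) → f ⊆ (R ⁽⁰⁾[ u ])
  ⁽¹⁾-galois R = ⁽⁰⁾-galois (flip R)

  ⁽⁰⁾⁽¹⁾-extensive : (R : U → W → Carrier) (f : U → Carrier) → f ⊆ (R ⁽⁰⁾[ R ⁽¹⁾[ f ] ])
  ⁽⁰⁾⁽¹⁾-extensive R f = ⁽¹⁾-galois R ⊆-refl

  ⁽⁰⁾-antitone : (R : U → W → Carrier) {u u′ : W → Carrier} →
                 u ⊆ u′ → (R ⁽⁰⁾[ u′ ]) ⊆ (R ⁽⁰⁾[ u ])
  ⁽⁰⁾-antitone R p = ⁽¹⁾-galois R (⊆-trans p (⁽⁰⁾-galois R ⊆-refl))

  -- R ⁽¹⁾[ f ] is definitionally (flip R) ⁽⁰⁾[ f ], so Closed (flip K) is closedness on the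
  -- other side of the polarity, and every lemma about ⁽⁰⁾ also covers ⁽¹⁾.
  Closed : (U → V → Carrier) → (U → Carrier) → Set _
  Closed K f = (K ⁽⁰⁾[ K ⁽¹⁾[ f ] ]) ⊆ f

  closed⇒stable : (K : U → V → Carrier) {f : U → Carrier} →
                  Closed K f → (K ⁽⁰⁾[ K ⁽¹⁾[ f ] ]) ≐ f
  closed⇒stable K {f} p = ⊆-antisym p (⁽⁰⁾⁽¹⁾-extensive K f)

  closure-monotone : (K : U → V → Carrier) {f g : U → Carrier} →
                     f ⊆ g → (K ⁽⁰⁾[ K ⁽¹⁾[ f ] ]) ⊆ (K ⁽⁰⁾[ K ⁽¹⁾[ g ] ])
  closure-monotone K p = ⁽⁰⁾-antitone K (⁽⁰⁾-antitone (flip K) p)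

  ⁽⁰⁾-closed : (K : U → V → Carrier) (u : V → Carrier) → Closed K (K ⁽⁰⁾[ u ])
  ⁽⁰⁾-closed K u = ⁽⁰⁾-antitone K (⁽⁰⁾⁽¹⁾-extensive (flip K) u)

  closed-resp-≐ : (K : U → V → Carrier) {f g : U → Carrier} →
                  f ≐ g → Closed K f → Closed K g
  closed-resp-≐ K f≐g p = ⊆-trans (closure-monotone K (≐⇒⊇ f≐g)) (⊆-trans p (≐⇒⊆ f≐g))

  ⋀-closed : (K : U → V → Carrier) {J : Set ι} (fs : J → U → Carrier) →
             (∀ j → Closed K (fs j)) → Closed K (λ a → ⋀ λ j → fs j a)
  ⋀-closed K fs p a = ⋀-greatest _ _ λ j →
    trans (closure-monotone K (λ b → ⋀-lower _ j) a) (p j a)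

  singleton-⊆ : (u : W → Carrier) (x : W) → ⟦ u x / x ⟧ ⊆ u
  singleton-⊆ u x y = ⋁-least _ _ λ { ≡-refl → refl }

  ⁽⁰⁾-≐-⋀-singletons : (R : U → W → Carrier) (u : W → Carrier) →
                       (R ⁽⁰⁾[ u ]) ≐ (λ a → ⋀ λ x → (R ⁽⁰⁾[ ⟦ u x / x ⟧ ]) a)
  ⁽⁰⁾-≐-⋀-singletons R u = ⊆-antisym
    (λ a → ⋀-greatest _ _ λ x → ⁽⁰⁾-antitone R (singleton-⊆ u x) a)
    (λ a → ⋀-greatest _ _ λ x →
      trans (⋀-lower _ x) (trans (⋀-lower _ x) (⇨ˡ-contravariant (⋁-upper _ ≡-refl))))

  ⁽⁰⁾-closed-if-singletons-closed :
    (K : U → V → Carrier) (R : U → W → Carrier) →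
    (∀ α x → Closed K (R ⁽⁰⁾[ ⟦ α / x ⟧ ])) → ∀ u → Closed K (R ⁽⁰⁾[ u ])
  ⁽⁰⁾-closed-if-singletons-closed K R singletons-closed u =
    closed-resp-≐ K (λ a → Eq.sym (⁽⁰⁾-≐-⋀-singletons R u a))
      (⋀-closed K _ λ x → singletons-closed (u x) x)

module ConceptLattice {c ℓ₁ ℓ₂ ι : Level} (𝐀 : CompleteHeytingAlgebra c ℓ₁ ℓ₂ ι)
                      (P : Contexts.FormalContext 𝐀) where
  open CompleteHeytingAlgebra 𝐀
  open Contexts 𝐀
  open FormalContext P
  open Polarity 𝐀

  concept-of-extent : (f : Obj → Carrier) → Closed I f → Concept P
  concept-of-extent f closed = (f , I ⁽¹⁾[ f ]) , (λ _ → Eq.refl) , closed⇒stable I closed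

  concept-of-intent : (u : Feat → Carrier) → Closed (flip I) u → Concept P
  concept-of-intent u closed = (I ⁽⁰⁾[ u ] , u) , closed⇒stable (flip I) closed , (λ _ → Eq.refl)

  extent-closed : (C : Concept P) → Closed I (ext P C)
  extent-closed ((f , u) , f↑≐u , u↓≐f) =
    ⊆-trans (⁽⁰⁾-antitone I (≐⇒⊇ f↑≐u)) (≐⇒⊆ u↓≐f)

  intent-≐-extent↑ : (C : Concept P) → int P C ≐ (I ⁽¹⁾[ ext P C ])
  intent-≐-extent↑ (_ , f↑≐u , _) a = Eq.sym (f↑≐u a)

  ⊑⇒intent-⊇ : (C D : Concept P) → ext P C ⊆ ext P D → int P D ⊆ int P C
  ⊑⇒intent-⊇ C D C⊑D = ⊆-trans (≐⇒⊆ (intent-≐-extent↑ D))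
    (⊆-trans (⁽⁰⁾-antitone (flip I) C⊑D) (≐⇒⊇ (intent-≐-extent↑ C)))

  extent-≐-intent↓ : (C : Concept P) → ext P C ≐ (I ⁽⁰⁾[ int P C ])
  extent-≐-intent↓ (_ , _ , u↓≐f) a = Eq.sym (u↓≐f a)

  intent-⊇⇒⊑ : (C D : Concept P) → int P D ⊆ int P C → ext P C ⊆ ext P D
  intent-⊇⇒⊑ C D D⊆C = ⊆-trans (≐⇒⊆ (extent-≐-intent↓ C))
    (⊆-trans (⁽⁰⁾-antitone I D⊆C) (≐⇒⊇ (extent-≐-intent↓ D)))

  meets : {J : Set ι} (cs : J → Concept P) → Σ (Concept P) (IsMeet P cs)
  meets cs = concept-of-extent _ (⋀-closed I _ λ j → extent-closed (cs j)) ,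
             (λ j a → ⋀-lower _ j) , (λ z z⊑cs a → ⋀-greatest _ _ λ j → z⊑cs j a)

  joins : {J : Set ι} (cs : J → Concept P) → Σ (Concept P) (IsJoin P cs)
  joins cs = concept-of-extent (I ⁽⁰⁾[ I ⁽¹⁾[ ⋁ext ] ]) (⁽⁰⁾-closed I _) ,
             (λ j → ⊆-trans (λ a → ⋁-upper _ j) (⁽⁰⁾⁽¹⁾-extensive I ⋁ext)) ,
             (λ z cs⊑z → ⊆-trans (closure-monotone I (λ a → ⋁-least _ _ λ j → cs⊑z j a))
                                 (extent-closed z))
    where
    ⋁ext : Obj → Carrier
    ⋁ext a = ⋁ λ j → ext P (cs j) a

module ModalOperators {c ℓ₁ ℓ₂ ι : Level} (𝐀 : CompleteHeytingAlgebra c ℓ₁ ℓ₂ ι)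
                      (F : Contexts.EnrichedContext 𝐀) where
  open CompleteHeytingAlgebra 𝐀
  open Contexts 𝐀
  open EnrichedContext F
  open Polarity 𝐀
  open ConceptLattice 𝐀 ℙ

  R□⁽⁰⁾-closed : ∀ u → Closed I (R□ ⁽⁰⁾[ u ])
  R□⁽⁰⁾-closed = ⁽⁰⁾-closed-if-singletons-closed I R□ λ α x → ≐⇒⊆ (compat-□⁰ α x)

  R□⁽¹⁾-closed : ∀ f → Closed (flip I) (R□ ⁽¹⁾[ f ])
  R□⁽¹⁾-closed = ⁽⁰⁾-closed-if-singletons-closed (flip I) (flip R□) λ α a → ≐⇒⊆ (compat-□¹ α a)

  R◇⁽⁰⁾-closed : ∀ f → Closed (flip I) (R◇ ⁽⁰⁾[ f ])
  R◇⁽⁰⁾-closed = ⁽⁰⁾-closed-if-singletons-closed (flip I) R◇ λ α a → ≐⇒⊆ (compat-◇⁰ α a)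

  R◇⁽¹⁾-closed : ∀ u → Closed I (R◇ ⁽¹⁾[ u ])
  R◇⁽¹⁾-closed = ⁽⁰⁾-closed-if-singletons-closed I (flip R◇) λ α x → ≐⇒⊆ (compat-◇¹ α x)

  [R□]-isConcept : (C : Concept ℙ) → IsConcept ℙ ([R□]-pair F C)
  [R□]-isConcept C = proj₂ (concept-of-extent _ (R□⁽⁰⁾-closed (int ℙ C)))

  ⟨R◇⟩-isConcept : (C : Concept ℙ) → IsConcept ℙ (⟨R◇⟩-pair F C)
  ⟨R◇⟩-isConcept C = proj₂ (concept-of-intent _ (R◇⁽⁰⁾-closed (ext ℙ C)))

  [R□] ⟨R◇⟩ : Concept ℙ → Concept ℙ
  [R□] C = [R□]-pair F C , [R□]-isConcept C
  ⟨R◇⟩ C = ⟨R◇⟩-pair F C , ⟨R◇⟩-isConcept C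

  [R□]-preserves-meets : {J : Set ι} (cs : J → Concept ℙ) (m : Concept ℙ) →
                         IsMeet ℙ cs m → IsMeet ℙ (λ j → [R□] (cs j)) ([R□] m)
  [R□]-preserves-meets cs m (m⊑cs , m-greatest) =
    (λ j → ⁽⁰⁾-antitone R□ (⊑⇒intent-⊇ m (cs j) (m⊑cs j))) ,
    λ z z⊑□cs →
      let z′ = concept-of-intent (R□ ⁽¹⁾[ ext ℙ z ]) (R□⁽¹⁾-closed (ext ℙ z))
          z′⊑cs : ∀ j → ext ℙ z′ ⊆ ext ℙ (cs j)
          z′⊑cs j = intent-⊇⇒⊑ z′ (cs j) (⁽⁰⁾-galois R□ (z⊑□cs j))
      in ⁽¹⁾-galois R□ (⊑⇒intent-⊇ z′ m (m-greatest z′ z′⊑cs))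

  ⟨R◇⟩-preserves-joins : {J : Set ι} (cs : J → Concept ℙ) (m : Concept ℙ) →
                         IsJoin ℙ cs m → IsJoin ℙ (λ j → ⟨R◇⟩ (cs j)) (⟨R◇⟩ m)
  ⟨R◇⟩-preserves-joins cs m (cs⊑m , m-least) =
    (λ j → intent-⊇⇒⊑ (⟨R◇⟩ (cs j)) (⟨R◇⟩ m) (⁽⁰⁾-antitone R◇ (cs⊑m j))) ,
    λ z ◇cs⊑z →
      let z′ = concept-of-extent (R◇ ⁽¹⁾[ int ℙ z ]) (R◇⁽¹⁾-closed (int ℙ z))
          cs⊑z′ : ∀ j → ext ℙ (cs j) ⊆ ext ℙ z′
          cs⊑z′ j = ⁽⁰⁾-galois R◇ (⊑⇒intent-⊇ (⟨R◇⟩ (cs j)) z (◇cs⊑z j))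
      in intent-⊇⇒⊑ (⟨R◇⟩ m) z (⁽¹⁾-galois R◇ (m-least z′ cs⊑z′))

lemma5p5 : {c ℓ₁ ℓ₂ ι : Level} (𝐀 : CompleteHeytingAlgebra c ℓ₁ ℓ₂ ι)
           (F : Contexts.EnrichedContext 𝐀) → Contexts.IsCompleteNormalLE 𝐀 F
lemma5p5 𝐀 F = record
  { meets        = meets
  ; joins        = joins
  ; [R□]-concept = [R□]-isConcept
  ; ⟨R◇⟩-concept = ⟨R◇⟩-isConcept
  ; [R□]-meet    = [R□]-preserves-meets
  ; ⟨R◇⟩-join    = ⟨R◇⟩-preserves-joins
  }
  where
  open ConceptLattice 𝐀 (Contexts.EnrichedContext.ℙ F)
  open ModalOperators 𝐀 F
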